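{- Fix a mode theory $\mathcal{M}$ (a strict 2-category) and consider the multimodal natural deduction system described in the context. The following two rules are admissible (i.e. whenever their premises are derivable, so is their conclusion). (Weakening) For all modes $p$, pre-contexts $\Gamma,\Delta$, modality $\mu$, formula $\varphi$ and formula $C$: if $\Gamma, (\mu \mid \varphi), \Delta \ \mathsf{ctx} \ @\, p$ and $\Gamma, \Delta \vdash C \ @\, p$ are derivable, then $\Gamma, (\mu\mid\varphi), \Delta \vdash C \ @\, p$ is derivable. (Exchange) For all modes $p$, pre-contexts $\Gamma,\Delta$, modalities $\mu,\nu$ and formulas $\varphi,\psi,C$: if $\Gamma, (\mu\mid\varphi), (\nu\mid\psi), \Delta \vdash C \ @\, p$ is derivable, then $\Gamma, (\nu\mid\psi), (\mu\mid\varphi), \Delta \vdash C \ @\, p$ is derivable.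
   Context: A mode theory is a strict 2-category $\mathcal{M}$. Its objects are called modes ($m,n,o,p,\dots$); its 1-cells $\mu : n \to m$ are called modalities, with composition $\mu\circ\nu : o \to m$ for $\nu : o\to n$, $\mu : n \to m$, and identities $1_m : m \to m$; its 2-cells $\alpha : \mu \Rightarrow \nu$ (between parallel modalities $\mu,\nu : n\to m$) are called transformations, with vertical composition $\beta\circ\alpha$, identities $1_\mu$, and horizontal composition $\alpha * \beta : \mu\circ\theta \Rightarrow \nu\circ\xi$ for $\alpha:\mu\Rightarrow\nu$, $\beta : \theta\Rightarrow\xi$, satisfying the strict 2-category laws. Formulas. Pre-formulas: $\varphi,\psi ::= p_i \mid \bot \mid \top \mid \varphi\lor\psi \mid \varphi\land\psi \mid (\mu\mid\varphi)\to\psi \mid \langle\mu\mid\varphi\rangle$ ($p_i$ propositional variables, $\mu$ a modality). The judgement "$\varphi$ wff $@\,m$" is generated by: $p_i,\top,\bot$ are wff at every mode; if $\varphi,\psi$ wff $@\,m$ then so are $\varphi\land\psi$, $\varphi\lor\psi$; if $\mu:n\to m$, $\varphi$ wff $@\,n$ and $\psi$ wff $@\,m$ then $(\mu\mid\varphi)\to\psi$ wff $@\,m$; if $\varphi$ wff $@\,n$ and $\mu:n\to m$ then $\langle\mu\mid\varphi\rangle$ wff $@\,m$. Write $\varphi\to\psi$ for $(1_m\mid\varphi)\to\psi$. Contexts. Pre-contexts: $\Gamma ::= \cdot \mid \Gamma, (\mu\mid\varphi) \mid \Gamma.\mathsf{lock}_\mu$. The judgement "$\Gamma$ ctx $@\,m$"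 is generated by: $\cdot$ ctx $@\,m$; if $\Gamma$ ctx $@\,m$, $\mu : n\to m$ and $\varphi$ wff $@\,n$ then $\Gamma,(\mu\mid\varphi)$ ctx $@\,m$; if $\Gamma$ ctx $@\,m$ and $\mu : n \to m$ then $\Gamma.\mathsf{lock}_\mu$ ctx $@\,n$. Contexts are identified modulo $\Gamma.\mathsf{lock}_{1_m} = \Gamma$ and $\Gamma.\mathsf{lock}_\mu.\mathsf{lock}_\nu = \Gamma.\mathsf{lock}_{\mu\circ\nu}$. $\Gamma,\Delta$ denotes concatenation of pre-contexts. Define $|\cdot| = 1$, $|\Gamma,(\mu\mid\varphi)| = |\Gamma|$, $|\Gamma.\mathsf{lock}_\mu| = |\Gamma|\circ\mu$. Derivability of $\Gamma\vdash\varphi\ @\,m$ is generated by the rules: (var) if $\mu : n\to m$ and $\alpha : \mu\Rightarrow |\Delta|$ then $\Gamma,(\mu\mid\varphi),\Delta \vdash \varphi\ @\,n$; ($\top$) $\Gamma\vdash\top\ @\,m$; ($\bot$E) from $\Gamma\vdash\bot\ @\,m$ infer $\Gamma\vdash\varphi\ @\,m$; ($\land$I) from $\Gamma\vdash\varphi$ and $\Gamma\vdash\psi$ infer $\Gamma\vdash\varphi\land\psi$; ($\land$E) from $\Gamma\vdash\varphi_1\land\varphi_2$ infer $\Gamma\vdash\varphi_i$; ($\lor$I) from $\Gamma\vdash\varphi_i$ infer $\Gamma\vdash\varphi_1\lor\varphi_2$; ($\lor$E) from $\Gamma\vdash\varphi\lor\psi$, $\Gamma,(1\mid\varphi)\vdash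 C$, $\Gamma,(1\mid\psi)\vdash C$ infer $\Gamma\vdash C$ (all at the same mode $m$); ($\to$I) from $\Gamma,(\mu\mid\varphi)\vdash\psi\ @\,m$ infer $\Gamma\vdash(\mu\mid\varphi)\to\psi\ @\,m$; ($\to$E) if $\mu:n\to m$, from $\Gamma\vdash(\mu\mid\varphi)\to\psi\ @\,m$ and $\Gamma.\mathsf{lock}_\mu\vdash\varphi\ @\,n$ infer $\Gamma\vdash\psi\ @\,m$; (modI) if $\mu:n\to m$, from $\Gamma.\mathsf{lock}_\mu\vdash\varphi\ @\,n$ infer $\Gamma\vdash\langle\mu\mid\varphi\rangle\ @\,m$; (modE) if $\nu:o\to n$, $\mu:n\to m$, from $\Gamma.\mathsf{lock}_\mu\vdash\langle\nu\mid\varphi\rangle\ @\,n$ and $\Gamma,(\mu\circ\nu\mid\varphi)\vdash\psi\ @\,m$ infer $\Gamma\vdash\psi\ @\,m$. -}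

module Defs where

open import Level using (Level; _⊔_) renaming (suc to lsuc)
open import Data.Nat using (ℕ)
open import Relation.Binary.PropositionalEquality using (_≡_; subst₂)

-- Mod n m  is the type of modalities (1-cells) μ : n → m.
-- μ ⇒ ν     is the type of transformations (2-cells) between parallel
--           modalities.

record ModeTheory (o a b : Level) : Set (lsuc (o ⊔ a ⊔ b)) where
  infixr 9 _∘₁_
  infixr 9 _∘₂_
  infixr 8 _*_
  field
    Mode : Set o
    Mod  : Mode → Mode → Set a
    _⇒_  : ∀ {n m} → Mod n m → Mod n m → Set b

    id₁  : ∀ {m} → Mod m m
    _∘₁_ : ∀ {o′ n m} → Mod n m → Mod o′ n → Mod o′ m
    ∘₁-identityˡ : ∀ {n m} (μ : Mod n m) → id₁ ∘₁ μ ≡ μ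
    ∘₁-identityʳ : ∀ {n m} (μ : Mod n m) → μ ∘₁ id₁ ≡ μ
    ∘₁-assoc : ∀ {p o′ n m} (μ : Mod n m) (ν : Mod o′ n) (ρ : Mod p o′) →
               (μ ∘₁ ν) ∘₁ ρ ≡ μ ∘₁ (ν ∘₁ ρ)

    id₂  : ∀ {n m} {μ : Mod n m} → μ ⇒ μ
    _∘₂_ : ∀ {n m} {μ ν ρ : Mod n m} → ν ⇒ ρ → μ ⇒ ν → μ ⇒ ρ
    ∘₂-identityˡ : ∀ {n m} {μ ν : Mod n m} (α : μ ⇒ ν) → id₂ ∘₂ α ≡ α
    ∘₂-identityʳ : ∀ {n m} {μ ν : Mod n m} (α : μ ⇒ ν) → α ∘₂ id₂ ≡ α
    ∘₂-assoc : ∀ {n m} {μ ν ρ σ : Mod n m}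
               (γ : ρ ⇒ σ) (β : ν ⇒ ρ) (α : μ ⇒ ν) →
               (γ ∘₂ β) ∘₂ α ≡ γ ∘₂ (β ∘₂ α)

    _*_ : ∀ {o′ n m} {μ ν : Mod n m} {θ ξ : Mod o′ n} →
          μ ⇒ ν → θ ⇒ ξ → (μ ∘₁ θ) ⇒ (ν ∘₁ ξ)
    *-id₂ : ∀ {o′ n m} (μ : Mod n m) (θ : Mod o′ n) →
            id₂ {μ = μ} * id₂ {μ = θ} ≡ id₂ {μ = μ ∘₁ θ}
    interchange : ∀ {o′ n m} {μ ν ρ : Mod n m} {θ ξ ζ : Mod o′ n}
                  (β : ν ⇒ ρ) (α : μ ⇒ ν) (δ : ξ ⇒ ζ) (γ : θ ⇒ ξ) →
                  (β ∘₂ α) * (δ ∘₂ γ) ≡ (β * δ) ∘₂ (α * γ)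
    *-identityˡ : ∀ {n m} {μ ν : Mod n m} (α : μ ⇒ ν) →
                  subst₂ _⇒_ (∘₁-identityˡ μ) (∘₁-identityˡ ν)
                         (id₂ {μ = id₁} * α) ≡ α
    *-identityʳ : ∀ {n m} {μ ν : Mod n m} (α : μ ⇒ ν) →
                  subst₂ _⇒_ (∘₁-identityʳ μ) (∘₁-identityʳ ν)
                         (α * id₂ {μ = id₁}) ≡ α
    *-assoc : ∀ {p o′ n m} {μ ν : Mod n m} {θ ξ : Mod o′ n} {ρ σ : Mod p o′}
              (α : μ ⇒ ν) (β : θ ⇒ ξ) (γ : ρ ⇒ σ) →
              subst₂ _⇒_ (∘₁-assoc μ θ ρ) (∘₁-assoc ν ξ σ) ((α * β) * γ)
                ≡ α * (β * γ)

module MND {o a b : Level} (M : ModeTheory o a b) where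
  open ModeTheory M

  data Form : Set (o ⊔ a) where
    pv   : ℕ → Form
    ⊥f   : Form
    ⊤f   : Form
    _∨f_ : Form → Form → Form
    _∧f_ : Form → Form → Form
    imp  : ∀ {n m} → Mod n m → Form → Form → Form
    dia  : ∀ {n m} → Mod n m → Form → Form

  data WF : Form → Mode → Set (o ⊔ a) where
    wf-pv  : ∀ {m} i → WF (pv i) m
    wf-⊤   : ∀ {m} → WF ⊤f m
    wf-⊥   : ∀ {m} → WF ⊥f m
    wf-∧   : ∀ {m φ ψ} → WF φ m → WF ψ m → WF (φ ∧f ψ) m
    wf-∨   : ∀ {m φ ψ} → WF φ m → WF ψ m → WF (φ ∨f ψ) m
    wf-imp : ∀ {n m φ ψ} (μ : Mod n m) → WF φ n → WF ψ m → WF (imp μ φ ψ) m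
    wf-dia : ∀ {n m φ} (μ : Mod n m) → WF φ n → WF (dia μ φ) m

  infixl 5 _,[_∣_] _·lock_
  data Ctx : Set (o ⊔ a) where
    ∙       : Ctx
    _,[_∣_] : ∀ {n m} → Ctx → Mod n m → Form → Ctx
    _·lock_ : ∀ {n m} → Ctx → Mod n m → Ctx

  infixl 4 _++_
  _++_ : Ctx → Ctx → Ctx
  Γ ++ ∙ = Γ
  Γ ++ (Δ ,[ μ ∣ φ ]) = (Γ ++ Δ) ,[ μ ∣ φ ]
  Γ ++ (Δ ·lock μ) = (Γ ++ Δ) ·lock μ

  data CtxOK : Ctx → Mode → Set (o ⊔ a) where
    ok-∙    : ∀ {m} → CtxOK ∙ m
    ok-var  : ∀ {n m Γ φ} → CtxOK Γ m → (μ : Mod n m) → WF φ n →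
              CtxOK (Γ ,[ μ ∣ φ ]) m
    ok-lock : ∀ {n m Γ} → CtxOK Γ m → (μ : Mod n m) → CtxOK (Γ ·lock μ) n

  data _≈_ : Ctx → Ctx → Set (o ⊔ a) where
    ≈-refl  : ∀ {Γ} → Γ ≈ Γ
    ≈-sym   : ∀ {Γ Γ′} → Γ ≈ Γ′ → Γ′ ≈ Γ
    ≈-trans : ∀ {Γ Γ′ Γ″} → Γ ≈ Γ′ → Γ′ ≈ Γ″ → Γ ≈ Γ″
    ≈-lock-id   : ∀ {m Γ} → (Γ ·lock (id₁ {m})) ≈ Γ
    ≈-lock-comp : ∀ {o′ n m Γ} (μ : Mod n m) (ν : Mod o′ n) →
                  ((Γ ·lock μ) ·lock ν) ≈ (Γ ·lock (μ ∘₁ ν))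
    ≈-cong-var  : ∀ {n m Γ Γ′} (μ : Mod n m) (φ : Form) →
                  Γ ≈ Γ′ → (Γ ,[ μ ∣ φ ]) ≈ (Γ′ ,[ μ ∣ φ ])
    ≈-cong-lock : ∀ {n m Γ Γ′} (μ : Mod n m) →
                  Γ ≈ Γ′ → (Γ ·lock μ) ≈ (Γ′ ·lock μ)

  data Locks (m : Mode) : Ctx → (n : Mode) → Mod n m → Set (o ⊔ a) where
    locks-∙    : Locks m ∙ m id₁
    locks-var  : ∀ {n Δ λ′ k l} {μ : Mod k l} {φ} →
                 Locks m Δ n λ′ → Locks m (Δ ,[ μ ∣ φ ]) n λ′
    locks-lock : ∀ {n o′ Δ λ′} → Locks m Δ n λ′ → (κ : Mod o′ n) →
                 Locks m (Δ ·lock κ) o′ (λ′ ∘₁ κ)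

  -- Derivability Γ ⊢ φ @ m.  Since contexts are identified modulo _≈_,
  -- derivability is closed under _≈_ (rule conv).
  infix 3 _⊢_at_
  data _⊢_at_ : Ctx → Form → Mode → Set (o ⊔ a ⊔ b) where
    conv  : ∀ {Γ Γ′ φ m} → Γ ≈ Γ′ → Γ ⊢ φ at m → Γ′ ⊢ φ at m
    var   : ∀ {n m} Γ Δ (μ : Mod n m) φ {λ′ : Mod n m} →
            Locks m Δ n λ′ → μ ⇒ λ′ →
            ((Γ ,[ μ ∣ φ ]) ++ Δ) ⊢ φ at n
    ⊤I    : ∀ {Γ m} → Γ ⊢ ⊤f at m
    ⊥E    : ∀ {Γ m φ} → Γ ⊢ ⊥f at m → Γ ⊢ φ at m
    ∧I    : ∀ {Γ m φ ψ} → Γ ⊢ φ at m → Γ ⊢ ψ at m → Γ ⊢ (φ ∧f ψ) at m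
    ∧E₁   : ∀ {Γ m φ ψ} → Γ ⊢ (φ ∧f ψ) at m → Γ ⊢ φ at m
    ∧E₂   : ∀ {Γ m φ ψ} → Γ ⊢ (φ ∧f ψ) at m → Γ ⊢ ψ at m
    ∨I₁   : ∀ {Γ m φ ψ} → Γ ⊢ φ at m → Γ ⊢ (φ ∨f ψ) at m
    ∨I₂   : ∀ {Γ m φ ψ} → Γ ⊢ ψ at m → Γ ⊢ (φ ∨f ψ) at m
    ∨E    : ∀ {Γ m φ ψ C} → Γ ⊢ (φ ∨f ψ) at m →
            (Γ ,[ id₁ {m} ∣ φ ]) ⊢ C at m →
            (Γ ,[ id₁ {m} ∣ ψ ]) ⊢ C at m → Γ ⊢ C at m
    →I    : ∀ {Γ n m φ ψ} (μ : Mod n m) →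
            (Γ ,[ μ ∣ φ ]) ⊢ ψ at m → Γ ⊢ imp μ φ ψ at m
    →E    : ∀ {Γ n m φ ψ} (μ : Mod n m) →
            Γ ⊢ imp μ φ ψ at m → (Γ ·lock μ) ⊢ φ at n → Γ ⊢ ψ at m
    modI  : ∀ {Γ n m φ} (μ : Mod n m) →
            (Γ ·lock μ) ⊢ φ at n → Γ ⊢ dia μ φ at m
    modE  : ∀ {Γ o′ n m φ ψ} (ν : Mod o′ n) (μ : Mod n m) →
            (Γ ·lock μ) ⊢ dia ν φ at n →
            (Γ ,[ μ ∘₁ ν ∣ φ ]) ⊢ ψ at m → Γ ⊢ ψ at m

-- Both rules are instances of one induction over derivations that carries a
-- relation between source and target context (admissible), so only the
-- variable rule needs an argument.  Its difficulty is the conversion rule: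
-- the variable is looked up in a context only ≈-equal to the displayed one.
-- Since ≈ merely rewrites runs of locks, the occurrence can still be located
-- up to ≈ (split-≈).  For exchange the suffix behind the occurrence is
-- rebuilt with literally the same locks and conv absorbs the rest.  For
-- weakening the new variable may cut through locks that the source had
-- merged, so one needs coherence: ≈-equal well-typed lock words compose to
-- the same modality.  Oriented, the two identifications form a terminating,
-- locally confluent rewriting system, hence a confluent one (Newman), and
-- rewriting preserves composites; this is where well-formedness of the
-- weakened context is used.

module Submission where

open import Defs
open import Level using (Level; _⊔_)
open import Data.Product using (Σ; ∃; _×_; _,_; proj₁; proj₂; swap)
open import Data.Sum using (_⊎_; inj₁; inj₂)
open import Data.Nat using (_<_; s≤s)
open import Data.Nat.Properties using (≤-refl; <-trans)
open import Data.Nat.Induction using (<-wellFounded)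
open import Data.List using (List; []; _∷_; length)
open import Induction.WellFounded using (module Subrelation)
import Relation.Binary.Construct.On as On
open import Relation.Binary.Construct.Closure.ReflexiveTransitive using (Star; ε; _◅_; _◅◅_)
open import Relation.Binary.Construct.Closure.Transitive using (Plus; [_]; _∼⁺⟨_⟩_)
open import Relation.Binary.Construct.Closure.Symmetric using (fwd; bwd)
open import Relation.Binary.Construct.Closure.Equivalence using (EqClosure; symmetric; gmap)
open import Relation.Binary.Rewriting
  using (WeaklyConfluent; StronglyNormalizing; Confluent; sn&wcr⇒cr)
open import Relation.Binary.PropositionalEquality using (_≡_; refl; sym; trans; cong; subst)

module LockWords {o a b : Level} (M : ModeTheory o a b) where
  open ModeTheory M

  Cell : Set (o ⊔ a)
  Cell = Σ Mode λ n → Σ Mode λ m → Mod n m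

  -- The innermost lock comes first, so that consing a cell is locking.
  Word : Set (o ⊔ a)
  Word = List Cell

  infix 4 _⟶_ _⟶*_ _≈ʷ_
  data _⟶_ : Word → Word → Set (o ⊔ a) where
    drop-id : ∀ {m} w → ((m , m , id₁) ∷ w) ⟶ w
    merge   : ∀ {o′ n m} (μ : Mod n m) (ν : Mod o′ n) w →
              ((o′ , n , ν) ∷ (n , m , μ) ∷ w) ⟶ ((o′ , m , μ ∘₁ ν) ∷ w)
    under   : ∀ c {w w′} → w ⟶ w′ → (c ∷ w) ⟶ (c ∷ w′)

  _⟶*_ : Word → Word → Set (o ⊔ a)
  _⟶*_ = Star _⟶_

  _≈ʷ_ : Word → Word → Set (o ⊔ a)
  _≈ʷ_ = EqClosure _⟶_

  Joinable : Word → Word → Set (o ⊔ a)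
  Joinable u v = ∃ λ w → u ⟶* w × v ⟶* w

  Joinable-sym : ∀ {u v} → Joinable u v → Joinable v u
  Joinable-sym (w , p , q) = w , q , p

  head-≡ : ∀ {n m} {μ ν : Mod n m} w → μ ≡ ν → ((n , m , μ) ∷ w) ⟶* ((n , m , ν) ∷ w)
  head-≡ w refl = ε

  under* : ∀ c {u v} → u ⟶* v → (c ∷ u) ⟶* (c ∷ v)
  under* c ε       = ε
  under* c (s ◅ p) = under c s ◅ under* c p

  drop-id-under : ∀ {m w v} → w ⟶ v → Joinable w ((m , m , id₁) ∷ v)
  drop-id-under s = _ , s ◅ ε , drop-id _ ◅ ε

  merge-under : ∀ {o′ n m} (μ : Mod n m) (ν : Mod o′ n) w {v} →
                ((n , m , μ) ∷ w) ⟶ v → Joinable ((o′ , m , μ ∘₁ ν) ∷ w) ((o′ , n , ν) ∷ v)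
  merge-under μ ν w (drop-id _) = _ , head-≡ w (∘₁-identityˡ ν) , ε
  merge-under μ ν _ (merge ρ _ w) =
    _ , merge ρ (μ ∘₁ ν) w ◅ ε , merge (ρ ∘₁ μ) ν w ◅ head-≡ w (∘₁-assoc ρ μ ν)
  merge-under μ ν _ (under _ s) = _ , under _ s ◅ ε , merge μ ν _ ◅ ε

  ⟶-weaklyConfluent : WeaklyConfluent _⟶_
  ⟶-weaklyConfluent (drop-id w)   (drop-id _)    = w , ε , ε
  ⟶-weaklyConfluent (drop-id _)   (merge μ _ w)  = _ , ε , head-≡ w (∘₁-identityʳ μ)
  ⟶-weaklyConfluent (drop-id _)   (under _ s)    = drop-id-under s
  ⟶-weaklyConfluent (merge μ _ w) (drop-id _)    = _ , head-≡ w (∘₁-identityʳ μ) , ε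
  ⟶-weaklyConfluent (merge _ _ _) (merge _ _ _)  = _ , ε , ε
  ⟶-weaklyConfluent (merge μ ν w) (under _ s)    = merge-under μ ν w s
  ⟶-weaklyConfluent (under _ s)   (drop-id _)    = Joinable-sym (drop-id-under s)
  ⟶-weaklyConfluent (under _ s)   (merge μ ν w)  = Joinable-sym (merge-under μ ν w s)
  ⟶-weaklyConfluent (under c s)   (under _ s′)   =
    let (j , p , q) = ⟶-weaklyConfluent s s′ in c ∷ j , under* c p , under* c q

  ⟶-shortens : ∀ {u v} → u ⟶ v → length v < length u
  ⟶-shortens (drop-id _)   = ≤-refl
  ⟶-shortens (merge _ _ _) = ≤-refl
  ⟶-shortens (under _ s)   = s≤s (⟶-shortens s)

  ⟶⁺-shortens : ∀ {u v} → Plus _⟶_ u v → length v < length u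
  ⟶⁺-shortens [ s ]          = ⟶-shortens s
  ⟶⁺-shortens (_ ∼⁺⟨ p ⟩ q) = <-trans (⟶⁺-shortens q) (⟶⁺-shortens p)

  ⟶⁺-stronglyNormalizing : StronglyNormalizing (Plus _⟶_)
  ⟶⁺-stronglyNormalizing =
    Subrelation.wellFounded ⟶⁺-shortens (On.wellFounded length <-wellFounded)

  ⟶-confluent : Confluent _⟶_
  ⟶-confluent = sn&wcr⇒cr ⟶⁺-stronglyNormalizing ⟶-weaklyConfluent

  ≈ʷ-joinable : ∀ {u v} → u ≈ʷ v → Joinable u v
  ≈ʷ-joinable ε = _ , ε , ε
  ≈ʷ-joinable (fwd s ◅ r) = let (w , p , q) = ≈ʷ-joinable r in w , s ◅ p , q
  ≈ʷ-joinable (bwd s ◅ r) =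
    let (w , p , q) = ≈ʷ-joinable r
        (d , p′ , q′) = ⟶-confluent (s ◅ ε) p
    in d , p′ , q ◅◅ q′

  data Typed (m : Mode) : Word → (n : Mode) → Mod n m → Set (o ⊔ a) where
    []  : Typed m [] m id₁
    _∷_ : ∀ {w n o′ ξ} → Typed m w n ξ → (κ : Mod o′ n) →
          Typed m ((o′ , n , κ) ∷ w) o′ (ξ ∘₁ κ)

  Typed-unique : ∀ {m w n ξ ξ′} → Typed m w n ξ → Typed m w n ξ′ → ξ ≡ ξ′
  Typed-unique []      []       = refl
  Typed-unique (d ∷ κ) (d′ ∷ .κ) = cong (_∘₁ κ) (Typed-unique d d′)

  Typed-⟶ : ∀ {m u v n ξ} → Typed m u n ξ → u ⟶ v → ∃ λ ξ′ → Typed m v n ξ′ × ξ ≡ ξ′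
  Typed-⟶ (d ∷ _)       (drop-id _)   = _ , d , ∘₁-identityʳ _
  Typed-⟶ ((d ∷ μ) ∷ ν) (merge μ ν _) = _ , d ∷ (μ ∘₁ ν) , ∘₁-assoc _ μ ν
  Typed-⟶ (d ∷ κ)       (under _ s)   =
    let (ξ′ , d′ , eq) = Typed-⟶ d s in _ , d′ ∷ κ , cong (_∘₁ κ) eq

  Typed-⟶* : ∀ {m u v n ξ} → Typed m u n ξ → u ⟶* v → ∃ λ ξ′ → Typed m v n ξ′ × ξ ≡ ξ′
  Typed-⟶* d ε       = _ , d , refl
  Typed-⟶* d (s ◅ p) =
    let (_ , d′ , eq) = Typed-⟶ d s
        (ξ″ , d″ , eq′) = Typed-⟶* d′ p
    in ξ″ , d″ , trans eq eq′

  Typed-≈ʷ : ∀ {m u v n ξ ξ′} → Typed m u n ξ → Typed m v n ξ′ → u ≈ʷ v → ξ ≡ ξ′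
  Typed-≈ʷ d d′ u≈v =
    let (_ , p , q) = ≈ʷ-joinable u≈v
        (_ , e , eq) = Typed-⟶* d p
        (_ , e′ , eq′) = Typed-⟶* d′ q
    in trans eq (trans (Typed-unique e e′) (sym eq′))

module Admissibility {o a b : Level} (M : ModeTheory o a b) where
  open ModeTheory M
  open MND M
  open LockWords M

  lockWord : Ctx → Word
  lockWord ∙              = []
  lockWord (Γ ,[ _ ∣ _ ]) = lockWord Γ
  lockWord (Γ ·lock κ)    = (_ , _ , κ) ∷ lockWord Γ

  lockWord-++ : ∀ {X Y} → lockWord X ≡ lockWord Y → ∀ Δ → lockWord (X ++ Δ) ≡ lockWord (Y ++ Δ)
  lockWord-++ eq ∙              = eq
  lockWord-++ eq (Δ ,[ _ ∣ _ ]) = lockWord-++ eq Δ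
  lockWord-++ eq (Δ ·lock κ)    = cong (_ ∷_) (lockWord-++ eq Δ)

  ≈⇒≈ʷ : ∀ {Γ Γ′} → Γ ≈ Γ′ → lockWord Γ ≈ʷ lockWord Γ′
  ≈⇒≈ʷ ≈-refl              = ε
  ≈⇒≈ʷ (≈-sym e)           = symmetric _⟶_ (≈⇒≈ʷ e)
  ≈⇒≈ʷ (≈-trans e e′)      = ≈⇒≈ʷ e ◅◅ ≈⇒≈ʷ e′
  ≈⇒≈ʷ ≈-lock-id           = fwd (drop-id _) ◅ ε
  ≈⇒≈ʷ (≈-lock-comp μ ν)   = fwd (merge μ ν _) ◅ ε
  ≈⇒≈ʷ (≈-cong-var _ _ e)  = ≈⇒≈ʷ e
  ≈⇒≈ʷ (≈-cong-lock _ e)   = gmap (_ ∷_) (under _) (≈⇒≈ʷ e)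

  Locks⇒Typed : ∀ {m Δ n ξ} → Locks m Δ n ξ → Typed m (lockWord Δ) n ξ
  Locks⇒Typed locks-∙          = []
  Locks⇒Typed (locks-var L)    = Locks⇒Typed L
  Locks⇒Typed (locks-lock L κ) = Locks⇒Typed L ∷ κ

  Typed⇒Locks : ∀ {m} Δ {n ξ} → Typed m (lockWord Δ) n ξ → Locks m Δ n ξ
  Typed⇒Locks ∙              []        = locks-∙
  Typed⇒Locks (Δ ,[ _ ∣ _ ]) d         = locks-var (Typed⇒Locks Δ d)
  Typed⇒Locks (Δ ·lock κ)    (d ∷ .κ)  = locks-lock (Typed⇒Locks Δ d) κ

  Locks-lockWord : ∀ {m Δ Δ′ n ξ} → lockWord Δ ≡ lockWord Δ′ → Locks m Δ n ξ → Locks m Δ′ n ξ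
  Locks-lockWord {Δ′ = Δ′} eq L = Typed⇒Locks Δ′ (subst (λ w → Typed _ w _ _) eq (Locks⇒Typed L))

  Locks-coherent : ∀ {m Δ Δ′ n ξ ξ′} → Locks m Δ n ξ → Locks m Δ′ n ξ′ →
                   lockWord Δ ≈ʷ lockWord Δ′ → ξ ≡ ξ′
  Locks-coherent L L′ = Typed-≈ʷ (Locks⇒Typed L) (Locks⇒Typed L′)

  ++-congʳ : ∀ Ξ {Δ Δ′} → Δ ≈ Δ′ → (Ξ ++ Δ) ≈ (Ξ ++ Δ′)
  ++-congʳ Ξ ≈-refl              = ≈-refl
  ++-congʳ Ξ (≈-sym e)           = ≈-sym (++-congʳ Ξ e)
  ++-congʳ Ξ (≈-trans e e′)      = ≈-trans (++-congʳ Ξ e) (++-congʳ Ξ e′)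
  ++-congʳ Ξ ≈-lock-id           = ≈-lock-id
  ++-congʳ Ξ (≈-lock-comp μ ν)   = ≈-lock-comp μ ν
  ++-congʳ Ξ (≈-cong-var μ φ e)  = ≈-cong-var μ φ (++-congʳ Ξ e)
  ++-congʳ Ξ (≈-cong-lock μ e)   = ≈-cong-lock μ (++-congʳ Ξ e)

  ++-congˡ : ∀ {Ξ Ξ′} → Ξ ≈ Ξ′ → ∀ Δ → (Ξ ++ Δ) ≈ (Ξ′ ++ Δ)
  ++-congˡ e ∙              = e
  ++-congˡ e (Δ ,[ μ ∣ φ ]) = ≈-cong-var μ φ (++-congˡ e Δ)
  ++-congˡ e (Δ ·lock κ)    = ≈-cong-lock κ (++-congˡ e Δ)

  ++-cong : ∀ {Ξ Ξ′ Δ Δ′} → Ξ ≈ Ξ′ → Δ ≈ Δ′ → (Ξ ++ Δ) ≈ (Ξ′ ++ Δ′)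
  ++-cong {Ξ′ = Ξ′} {Δ = Δ} e e′ = ≈-trans (++-congˡ e Δ) (++-congʳ Ξ′ e′)

  data Split : Ctx → Ctx → ∀ {n m} → Mod n m → Form → Ctx → Set (o ⊔ a) where
    here      : ∀ {Γ n m} {μ : Mod n m} {φ} → Split (Γ ,[ μ ∣ φ ]) Γ μ φ ∙
    skip-var  : ∀ {Γ P Q n m k l} {μ : Mod n m} {φ} {ν : Mod k l} {ψ} →
                Split Γ P μ φ Q → Split (Γ ,[ ν ∣ ψ ]) P μ φ (Q ,[ ν ∣ ψ ])
    skip-lock : ∀ {Γ P Q n m k l} {μ : Mod n m} {φ} →
                Split Γ P μ φ Q → (κ : Mod k l) → Split (Γ ·lock κ) P μ φ (Q ·lock κ)

  module _ {n m} {μ : Mod n m} {φ : Form} where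

    split : ∀ P Q → Split ((P ,[ μ ∣ φ ]) ++ Q) P μ φ Q
    split P ∙              = here
    split P (Q ,[ _ ∣ _ ]) = skip-var (split P Q)
    split P (Q ·lock κ)    = skip-lock (split P Q) κ

    Split⇒≡ : ∀ {Γ P Q} → Split Γ P μ φ Q → Γ ≡ ((P ,[ μ ∣ φ ]) ++ Q)
    Split⇒≡ here            = refl
    Split⇒≡ (skip-var s)    = cong (_,[ _ ∣ _ ]) (Split⇒≡ s)
    Split⇒≡ (skip-lock s κ) = cong (_·lock κ) (Split⇒≡ s)

    split-++ˡ : ∀ {Γ P Q} → Split Γ P μ φ Q → ∀ Δ → Split (Γ ++ Δ) P μ φ (Q ++ Δ)
    split-++ˡ s ∙              = s
    split-++ˡ s (Δ ,[ _ ∣ _ ]) = skip-var (split-++ˡ s Δ)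
    split-++ˡ s (Δ ·lock κ)    = skip-lock (split-++ˡ s Δ) κ

    split-++ʳ : ∀ Γ {Δ P Q} → Split Δ P μ φ Q → Split (Γ ++ Δ) (Γ ++ P) μ φ Q
    split-++ʳ Γ here            = here
    split-++ʳ Γ (skip-var s)    = skip-var (split-++ʳ Γ s)
    split-++ʳ Γ (skip-lock s κ) = skip-lock (split-++ʳ Γ s) κ

    split-++⁻ : ∀ Γ Δ {P Q} → Split (Γ ++ Δ) P μ φ Q →
                (∃ λ Q′ → Split Γ P μ φ Q′ × Q ≡ (Q′ ++ Δ)) ⊎ (∃ λ P′ → Split Δ P′ μ φ Q)
    split-++⁻ Γ ∙ s = inj₁ (_ , s , refl)
    split-++⁻ Γ (Δ ,[ _ ∣ _ ]) here = inj₂ (_ , here)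
    split-++⁻ Γ (Δ ,[ _ ∣ _ ]) (skip-var s) with split-++⁻ Γ Δ s
    ... | inj₁ (Q′ , s′ , refl) = inj₁ (Q′ , s′ , refl)
    ... | inj₂ (P′ , s′)        = inj₂ (P′ , skip-var s′)
    split-++⁻ Γ (Δ ·lock κ) (skip-lock s _) with split-++⁻ Γ Δ s
    ... | inj₁ (Q′ , s′ , refl) = inj₁ (Q′ , s′ , refl)
    ... | inj₂ (P′ , s′)        = inj₂ (P′ , skip-lock s′ κ)

    data SplitUpTo (Γ P Q : Ctx) : Set (o ⊔ a) where
      upto : ∀ {P′ Q′} → Split Γ P′ μ φ Q′ → P ≈ P′ → Q ≈ Q′ → SplitUpTo Γ P Q

  Transports : Ctx → Ctx → Set (o ⊔ a)
  Transports Γ Γ′ = ∀ {P Q n m} {μ : Mod n m} {φ} → Split Γ P μ φ Q → SplitUpTo {μ = μ} {φ} Γ′ P Q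

  transports-∘ : ∀ {Γ Γ′ Γ″} → Transports Γ′ Γ″ → Transports Γ Γ′ → Transports Γ Γ″
  transports-∘ g f s with f s
  ... | upto s′ p q with g s′
  ... | upto s″ p′ q′ = upto s″ (≈-trans p p′) (≈-trans q q′)

  transports-var : ∀ {Γ Γ′ n m} {μ : Mod n m} {φ} → Γ ≈ Γ′ → Transports Γ Γ′ →
                   Transports (Γ ,[ μ ∣ φ ]) (Γ′ ,[ μ ∣ φ ])
  transports-var e t here         = upto here e ≈-refl
  transports-var e t (skip-var s) with t s
  ... | upto s′ p q = upto (skip-var s′) p (≈-cong-var _ _ q)

  transports-lock : ∀ {Γ Γ′ n m} {κ : Mod n m} →
                    Transports Γ Γ′ → Transports (Γ ·lock κ) (Γ′ ·lock κ)
  transports-lock t (skip-lock s κ) with t s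
  ... | upto s′ p q = upto (skip-lock s′ κ) p (≈-cong-lock κ q)

  split-≈ : ∀ {Γ Γ′} → Γ ≈ Γ′ → Transports Γ Γ′ × Transports Γ′ Γ
  split-≈ ≈-refl            = (λ s → upto s ≈-refl ≈-refl) , (λ s → upto s ≈-refl ≈-refl)
  split-≈ (≈-sym e)         = swap (split-≈ e)
  split-≈ (≈-trans e e′)    =
    transports-∘ (proj₁ (split-≈ e′)) (proj₁ (split-≈ e)) ,
    transports-∘ (proj₂ (split-≈ e)) (proj₂ (split-≈ e′))
  split-≈ ≈-lock-id         =
    (λ { (skip-lock s _) → upto s ≈-refl ≈-lock-id }) ,
    (λ s → upto (skip-lock s id₁) ≈-refl (≈-sym ≈-lock-id))
  split-≈ (≈-lock-comp μ ν) =
    (λ { (skip-lock (skip-lock s _) _) → upto (skip-lock s (μ ∘₁ ν)) ≈-refl (≈-lock-comp μ ν) }) ,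
    (λ { (skip-lock s _) → upto (skip-lock (skip-lock s μ) ν) ≈-refl (≈-sym (≈-lock-comp μ ν)) })
  split-≈ (≈-cong-var μ φ e) =
    transports-var e (proj₁ (split-≈ e)) , transports-var (≈-sym e) (proj₂ (split-≈ e))
  split-≈ (≈-cong-lock μ e) =
    transports-lock (proj₁ (split-≈ e)) , transports-lock (proj₂ (split-≈ e))

  data Lookup (Γ : Ctx) {n m} (μ : Mod n m) (φ : Form) (w : Word) : Set (o ⊔ a) where
    found : ∀ {P Q} → Split Γ P μ φ Q → lockWord Q ≡ w → Lookup Γ μ φ w

  lookup-var : ∀ {Γ Q n m ξ} {μ : Mod n m} {φ} →
               Lookup Γ μ φ (lockWord Q) → Locks m Q n ξ → μ ⇒ ξ → Γ ⊢ φ at n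
  lookup-var (found {P} {Q′} s eq) L α =
    subst (λ Γ → Γ ⊢ _ at _) (sym (Split⇒≡ s)) (var P Q′ _ _ (Locks-lockWord (sym eq) L) α)

  record StructuralRule {ℓ} (_▷_at_ : Ctx → Ctx → Mode → Set ℓ) : Set (o ⊔ a ⊔ b ⊔ ℓ) where
    field
      ▷-≈      : ∀ {Γ Γ′ T m} → Γ ≈ Γ′ → Γ′ ▷ T at m → Γ ▷ T at m
      ▷-var    : ∀ {Γ T n m} → Γ ▷ T at m → (μ : Mod n m) (φ : Form) →
                 (Γ ,[ μ ∣ φ ]) ▷ (T ,[ μ ∣ φ ]) at m
      ▷-lock   : ∀ {Γ T n m} → Γ ▷ T at m → (μ : Mod n m) → (Γ ·lock μ) ▷ (T ·lock μ) at n
      ▷-lookup : ∀ {P Q T n m ξ} {μ : Mod n m} {φ} →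
                 ((P ,[ μ ∣ φ ]) ++ Q) ▷ T at n → Locks m Q n ξ → μ ⇒ ξ → T ⊢ φ at n

  module _ {ℓ} {_▷_at_ : Ctx → Ctx → Mode → Set ℓ} (R : StructuralRule _▷_at_) where
    open StructuralRule R

    admissible : ∀ {Γ T C m} → Γ ▷ T at m → Γ ⊢ C at m → T ⊢ C at m
    admissible r (conv e d)        = admissible (▷-≈ e r) d
    admissible r (var _ _ _ _ L α) = ▷-lookup r L α
    admissible r ⊤I                = ⊤I
    admissible r (⊥E d)            = ⊥E (admissible r d)
    admissible r (∧I d e)          = ∧I (admissible r d) (admissible r e)
    admissible r (∧E₁ d)           = ∧E₁ (admissible r d)
    admissible r (∧E₂ d)           = ∧E₂ (admissible r d)
    admissible r (∨I₁ d)           = ∨I₁ (admissible r d)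
    admissible r (∨I₂ d)           = ∨I₂ (admissible r d)
    admissible r (∨E {φ = φ} {ψ} d e f) =
      ∨E (admissible r d) (admissible (▷-var r id₁ φ) e) (admissible (▷-var r id₁ ψ) f)
    admissible r (→I {φ = φ} μ d)  = →I μ (admissible (▷-var r μ φ) d)
    admissible r (→E μ d e)        = →E μ (admissible r d) (admissible (▷-lock r μ) e)
    admissible r (modI μ d)        = modI μ (admissible (▷-lock r μ) d)
    admissible r (modE {φ = φ} ν μ d e) =
      modE ν μ (admissible (▷-lock r μ) d) (admissible (▷-var r (μ ∘₁ ν) φ) e)

  -- CtxOK without the well-formedness of formulas, which the rules extending
  -- the context do not preserve.
  data WellModed : Ctx → Mode → Set (o ⊔ a) where
    ∙    : ∀ {m} → WellModed ∙ m
    _,_∣_ : ∀ {Γ n m} → WellModed Γ m → (μ : Mod n m) (φ : Form) → WellModed (Γ ,[ μ ∣ φ ]) m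
    _·_  : ∀ {Γ n m} → WellModed Γ m → (μ : Mod n m) → WellModed (Γ ·lock μ) n

  CtxOK⇒WellModed : ∀ {Γ m} → CtxOK Γ m → WellModed Γ m
  CtxOK⇒WellModed ok-∙            = ∙
  CtxOK⇒WellModed (ok-var ok μ _) = CtxOK⇒WellModed ok , μ ∣ _
  CtxOK⇒WellModed (ok-lock ok μ)  = CtxOK⇒WellModed ok · μ

  WellModed-locks : ∀ {Γ P Q e n m} {μ : Mod n m} {φ} → WellModed Γ e → Split Γ P μ φ Q →
                    ∃ λ ξ → Locks m Q e ξ
  WellModed-locks (_ , _ ∣ _) here            = _ , locks-∙
  WellModed-locks (w , _ ∣ _) (skip-var s)    = let (ξ , L) = WellModed-locks w s in ξ , locks-var L
  WellModed-locks (w · κ)     (skip-lock s _) =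
    let (_ , L) = WellModed-locks w s in _ , locks-lock L κ

  split-weaken : ∀ A B {P Q n m k l} {μ : Mod n m} {φ} {ν : Mod k l} {ψ} →
                 Split (A ++ B) P μ φ Q → Lookup ((A ,[ ν ∣ ψ ]) ++ B) μ φ (lockWord Q)
  split-weaken A B s with split-++⁻ A B s
  ... | inj₁ (Q′ , s′ , refl) = found (split-++ˡ (skip-var s′) B) (lockWord-++ refl B)
  ... | inj₂ (P′ , s′)        = found (split-++ʳ _ s′) refl

  module Weakening (A : Ctx) {k l} (ν : Mod k l) (ψ : Form) where

    data _▷_at_ : Ctx → Ctx → Mode → Set (o ⊔ a) where
      weaken : ∀ {Γ B p} → Γ ≈ (A ++ B) → WellModed ((A ,[ ν ∣ ψ ]) ++ B) p →
               Γ ▷ ((A ,[ ν ∣ ψ ]) ++ B) at p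

    weakening : StructuralRule _▷_at_
    weakening = record
      { ▷-≈      = λ { e (weaken e′ w) → weaken (≈-trans e e′) w }
      ; ▷-var    = λ { (weaken e w) μ φ → weaken (≈-cong-var μ φ e) (w , μ ∣ φ) }
      ; ▷-lock   = λ { (weaken e w) μ → weaken (≈-cong-lock μ e) (w · μ) }
      ; ▷-lookup = lookup
      }
      where
      lookup : ∀ {P Q T n m ξ} {μ : Mod n m} {φ} →
               ((P ,[ μ ∣ φ ]) ++ Q) ▷ T at n → Locks m Q n ξ → μ ⇒ ξ → T ⊢ φ at n
      lookup {P} {Q} (weaken {B = B} e w) L α with proj₁ (split-≈ e) (split P Q)
      ... | upto {Q′ = Q′} s _ Q≈Q′ with split-weaken A B s
      ... | found s′ eq with WellModed-locks w s′
      ... | ξ′ , L′ =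
        lookup-var (found s′ eq) L″ (subst (_ ⇒_) (Locks-coherent L L″ (≈⇒≈ʷ Q≈Q′)) α)
        where
        L″ : Locks _ Q′ _ ξ′
        L″ = Locks-lockWord eq L′

  -- The locks C must stay behind whichever of the two swapped variables is
  -- looked up, so the rearranged context depends on the occurrence.
  split-exchange : ∀ A C B {P Q n m k l k′ l′} {μ : Mod n m} {φ}
                   {μx : Mod k l} {φx} {μy : Mod k′ l′} {φy} →
                   Split ((((A ,[ μx ∣ φx ]) ++ C) ,[ μy ∣ φy ]) ++ B) P μ φ Q →
                   Lookup ((((A ,[ μy ∣ φy ]) ,[ μx ∣ φx ]) ++ C) ++ B) μ φ (lockWord Q) ⊎
                   Lookup ((((A ++ C) ,[ μy ∣ φy ]) ,[ μx ∣ φx ]) ++ B) μ φ (lockWord Q)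
  split-exchange A C B s with split-++⁻ _ B s
  ... | inj₂ (_ , s′) = inj₁ (found (split-++ʳ _ s′) refl)
  ... | inj₁ (_ , here , refl) = inj₂ (found (split-++ˡ (skip-var here) B) (lockWord-++ refl B))
  ... | inj₁ (_ , skip-var s′ , refl) with split-++⁻ _ C s′
  ...   | inj₂ (_ , s″) = inj₁ (found (split-++ˡ (split-++ʳ _ s″) B) (lockWord-++ refl B))
  ...   | inj₁ (_ , here , refl) =
    inj₁ (found (split-++ˡ (split-++ˡ here C) B) (lockWord-++ refl B))
  ...   | inj₁ (_ , skip-var s″ , refl) =
    inj₁ (found (split-++ˡ (split-++ˡ (skip-var (skip-var s″)) C) B)
                (lockWord-++ (lockWord-++ refl C) B))

  module Exchange (A : Ctx) {k l k′ l′} (μx : Mod k l) (φx : Form) (μy : Mod k′ l′) (φy : Form)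
    where

    data _▷_at_ : Ctx → Ctx → Mode → Set (o ⊔ a) where
      exchange : ∀ {Γ B p} → Γ ≈ (((A ,[ μx ∣ φx ]) ,[ μy ∣ φy ]) ++ B) →
                 Γ ▷ (((A ,[ μy ∣ φy ]) ,[ μx ∣ φx ]) ++ B) at p

    exchanging : StructuralRule _▷_at_
    exchanging = record
      { ▷-≈      = λ { e (exchange e′) → exchange (≈-trans e e′) }
      ; ▷-var    = λ { (exchange {B = B} e) μ φ → exchange {B = B ,[ μ ∣ φ ]} (≈-cong-var μ φ e) }
      ; ▷-lock   = λ { (exchange {B = B} e) μ → exchange {B = B ·lock μ} (≈-cong-lock μ e) }
      ; ▷-lookup = lookup
      }
      where
      lookup : ∀ {P Q T n m ξ} {μ : Mod n m} {φ} →
               ((P ,[ μ ∣ φ ]) ++ Q) ▷ T at n → Locks m Q n ξ → μ ⇒ ξ → T ⊢ φ at n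
      -- First locate the two variables in the source itself:
      -- it is ((A′ , x) ++ C , y) ++ B′ with A′ ≈ A, C ≈ ∙ and B′ ≈ B.
      lookup {P} {Q} (exchange {B = B} e) L α
        with proj₂ (split-≈ e) (split (A ,[ μx ∣ φx ]) B)
      ... | upto {R} {B′} sy Ax≈R B≈B′ with proj₁ (split-≈ Ax≈R) here
      ... | upto {A′} {C} sx A≈A′ ∙≈C with Split⇒≡ sx
      ... | refl
        with split-exchange A′ C B′ (subst (λ Γ → Split Γ P _ _ Q) (Split⇒≡ sy) (split P Q))
      ... | inj₁ l = conv (++-cong (++-cong (≈-cong-var μx φx (≈-cong-var μy φy (≈-sym A≈A′)))
                                            (≈-sym ∙≈C))
                                   (≈-sym B≈B′))
                          (lookup-var l L α)
      ... | inj₂ l = conv (++-cong (≈-cong-var μx φx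
                                     (≈-cong-var μy φy (++-cong (≈-sym A≈A′) (≈-sym ∙≈C))))
                                   (≈-sym B≈B′))
                          (lookup-var l L α)

theorem1 : ∀ {o a b : Level} (M : ModeTheory o a b) →
    let open ModeTheory M
        open MND M
    in
    -- Weakening
    (∀ (p : Mode) (Γ Δ : Ctx) {n m : Mode} (μ : Mod n m) (φ C : Form) →
       CtxOK ((Γ ,[ μ ∣ φ ]) ++ Δ) p →
       (Γ ++ Δ) ⊢ C at p →
       ((Γ ,[ μ ∣ φ ]) ++ Δ) ⊢ C at p)
    ×
    -- Exchange
    (∀ (p : Mode) (Γ Δ : Ctx) {n m n′ m′ : Mode}
       (μ : Mod n m) (ν : Mod n′ m′) (φ ψ C : Form) →
       ((Γ ,[ μ ∣ φ ] ,[ ν ∣ ψ ]) ++ Δ) ⊢ C at p →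
       ((Γ ,[ ν ∣ ψ ] ,[ μ ∣ φ ]) ++ Δ) ⊢ C at p)
theorem1 M =
    (λ p Γ Δ μ φ C ok →
       admissible (Weakening.weakening Γ μ φ) (Weakening.weaken ≈-refl (CtxOK⇒WellModed ok)))
  , (λ p Γ Δ μ ν φ ψ C →
       admissible (Exchange.exchanging Γ μ φ ν ψ) (Exchange.exchange ≈-refl))
  where
  open Admissibility M
  open MND M using (≈-refl)
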